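{- Let $m$ be a positive integer and consider a frieze of type $D_m$, viewed as a positive integer weighting of the tagged arcs of a once-punctured $m$-gon, in which no arc has weight $1$. Then: (1) all untagged arcs incident with the puncture have the same weight, and all tagged arcs incident with the puncture have the same weight; (2) for every $d$, any arc not incident with the puncture which cuts out, together with boundary segments, a $(d+1)$-gon not containing the puncture has weight $d$; (3) if $x$ is the common weight of the tagged arcs incident with the puncture and $y$ is the common weight of the untagged arcs incident with the puncture, then $xy=m$.
   Context: A frieze of type $D_m$ is a ring homomorphism from the coefficient-free cluster algebra of type $D_m$ to $\mathbb{Z}$ sending every cluster variable to a positive integer. Via Schiffler's model, cluster variables of type $D_m$ correspond to tagged arcs in a once-punctured $m$-gon, and a frieze is an assignment of positive integer weights to tagged arcs (boundary segments having weight $1$) satisfying all exchange relations; e.g. for a quadrilateral with sides $a,b,c,d$ and diagonals $x,y$ one has $xy=ac+bd$, and for an arc $x$ from a boundary point $P$ around the puncture back to a point $Q$, etc., the relations of the cluster algebra hold. -}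

module Defs where

open import Data.Nat using (ℕ; zero; suc; _+_; _*_; _∸_; _≤_; _<_; z≤n; s≤s; _<?_)
open import Data.Nat.DivMod using (_mod_)
open import Data.Fin using (Fin; toℕ)
open import Data.Product using (_×_)
open import Relation.Nullary using (yes; no; ¬_)
open import Relation.Binary.PropositionalEquality using (_≡_)

-- Schiffler's model of type D_m: a once-punctured m-gon.
-- Boundary marked points are 0,1,…,m-1 (Fin m), in counterclockwise order.
--
-- Tagged arcs:
--  * peri i k  (2 ≤ k ≤ m-1): the arc not incident with the puncture that
--    goes from point i to point i+k (mod m) and cuts out, together with the
--    boundary segments i→i+1→…→i+k, the (k+1)-gon with vertices
--    i, i+1, …, i+k that does NOT contain the puncture.
--    (k = 1 would be a boundary segment; k = m would be the loop cutting
--    out a once-punctured monogon, which is not an arc.)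
--  * plain i   : the untagged (plain) arc from i to the puncture;
--  * notched i : the tagged (notched) arc from i to the puncture.

data TaggedArc (m : ℕ) : Set where
  peri    : (i : Fin m) (k : ℕ) → 2 ≤ k → k < m → TaggedArc m
  plain   : Fin m → TaggedArc m
  notched : Fin m → TaggedArc m

shift : ∀ {m} → Fin m → ℕ → Fin m
shift {suc n} i j = (toℕ i + j) mod (suc n)

-- Weight of the arc-or-boundary-segment from i to i+k cutting out the
-- (k+1)-gon i,…,i+k not containing the puncture, for 1 ≤ k ≤ m-1.
-- Boundary segments (k = 1) have weight 1.  (Value 0 outside the range
-- 1 ≤ k ≤ m-1 is junk and never used below.)
W : ∀ {m} → (TaggedArc m → ℕ) → Fin m → ℕ → ℕ
W w i zero = 0
W w i (suc zero) = 1
W {m} w i (suc (suc k)) with suc (suc k) <? m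
... | yes p = w (peri i (suc (suc k)) (s≤s (s≤s z≤n)) p)
... | no _  = 0

-- Exchange relations of the cluster algebra of type D_m, i.e. one relation
-- for each pair of tagged arcs related by a flip.

record IsFrieze (m : ℕ) (w : TaggedArc m → ℕ) : Set where
  field
    positive : ∀ γ → 0 < w γ
    -- two crossing arcs with four distinct endpoints a, c=a+p, b=a+q,
    -- d=a+r (counterclockwise), quadrilateral a,c,b,d not containing the
    -- puncture:  [a,b][c,d] = [a,c][b,d] + [c,b][a,d]
    ptolemy : ∀ (a : Fin m) (p q r : ℕ) → 0 < p → p < q → q < r → r < m →
      W w a q * W w (shift a p) (r ∸ p)
        ≡ W w a p * W w (shift a q) (r ∸ q) + W w (shift a p) (q ∸ p) * W w a r
    -- the arc [a,b], b = a+k, against the plain arc at x = a+j, a < x < b: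
    --  [a,b]·R(x) = [a,x]·R(b) + [x,b]·R(a)
    plainFlip : ∀ (a : Fin m) (j k : ℕ) → 0 < j → j < k → k < m →
      W w a k * w (plain (shift a j))
        ≡ W w a j * w (plain (shift a k)) + W w (shift a j) (k ∸ j) * w (plain a)
    notchedFlip : ∀ (a : Fin m) (j k : ℕ) → 0 < j → j < k → k < m →
      W w a k * w (notched (shift a j))
        ≡ W w a j * w (notched (shift a k)) + W w (shift a j) (k ∸ j) * w (notched a)
    -- the arc [a,b] (b = a+k) against the arc [x,a] (x = a+j, a < x < b),
    -- the quadrilateral a,x,b,a having the loop at a (= R(a)·N(a)) as a side:
    --  [a,b]·[x,a] = [a,x]·[b,a] + [x,b]·R(a)·N(a)
    loopFlipˡ : ∀ (a : Fin m) (j k : ℕ) → 0 < j → j < k → k < m →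
      W w a k * W w (shift a j) (m ∸ j)
        ≡ W w a j * W w (shift a k) (m ∸ k)
          + W w (shift a j) (k ∸ j) * (w (plain a) * w (notched a))
    -- mirror image, loop at b:
    --  [a,b]·[b,x] = [x,b]·[b,a] + [a,x]·R(b)·N(b)
    loopFlipʳ : ∀ (a : Fin m) (j k : ℕ) → 0 < j → j < k → k < m →
      W w a k * W w (shift a k) ((m ∸ k) + j)
        ≡ W w (shift a j) (k ∸ j) * W w (shift a k) (m ∸ k)
          + W w a j * (w (plain (shift a k)) * w (notched (shift a k)))
    -- a plain arc at i against a notched arc at b = i+k ≠ i:
    --  R(i)·N(b) = [i,b] + [b,i]
    tagFlip : ∀ (i : Fin m) (k : ℕ) → 0 < k → k < m →
      w (plain i) * w (notched (shift i k)) ≡ W w i k + W w (shift i k) (m ∸ k)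

-- Along any family of arcs to the puncture, the flip relation with the peripheral arc of
-- a triangle reads  [i,i+2]·R(i+1) = R(i) + R(i+2),  and [i,i+2] ≥ 2 because no weight is 1.
-- So i ↦ R(i) is a convex function on the m-cycle, hence constant: a maximum propagates to
-- its neighbours. With R constant the same flip relation forces [a,a+k] = k by induction on k,
-- and the relation  R(i)·N(i+1) = [i,i+1] + [i+1,i] = 1 + (m − 1)  gives xy = m.
-- For m = 2 that relation reads R·N = 2, impossible with both weights at least 2.
module Submission where

open import Defs
open import Data.Nat using (ℕ; _≤_; _<_; _*_)
open import Data.Fin using (Fin)
open import Data.Product using (_×_)
open import Relation.Nullary using (¬_)
open import Relation.Binary.PropositionalEquality using (_≡_)

open import Data.Nat using (zero; suc; _+_; _∸_; z≤n; s≤s; _<?_; NonZero; >-nonZero)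
open import Data.Nat.Properties
open import Data.Nat.DivMod using (_%_; _/_; _mod_; m%n<n; m≡m%n+[m/n]*n; [m+n]%n≡m%n; %-distribˡ-+; m%n%n≡m%n; m<n⇒m%n≡m)
open import Data.Fin using (toℕ; zero)
open import Data.Fin.Properties using (toℕ-injective; toℕ-fromℕ<; toℕ<n)
open import Data.List using (upTo)
open import Data.List.Extrema.Nat using (argmax; f[xs]≤f[argmax])
open import Data.List.Membership.Propositional.Properties using (∈-upTo⁺)
import Data.List.Relation.Unary.All as All
open import Data.Product using (_,_)
open import Data.Empty using (⊥-elim)
open import Function using (_∘_)
open import Relation.Nullary using (yes; no)
open import Relation.Binary.PropositionalEquality using (refl; sym; trans; cong; cong₂; subst; module ≡-Reasoning)

Convex : (ℕ → ℕ) → Set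
Convex h = ∀ k → h (suc k) + h (suc k) ≤ h k + h (suc (suc k))

Periodic : ℕ → (ℕ → ℕ) → Set
Periodic m h = ∀ k → h (k + m) ≡ h k

module _ {m} {h : ℕ → ℕ} (periodic : Periodic m h) where

  periodic-+* : ∀ k j → h (k + j * m) ≡ h k
  periodic-+* k zero    = cong h (+-identityʳ k)
  periodic-+* k (suc j) = begin
    h (k + (m + j * m))  ≡⟨ cong h (trans (cong (k +_) (+-comm m (j * m))) (sym (+-assoc k (j * m) m))) ⟩
    h (k + j * m + m)    ≡⟨ periodic (k + j * m) ⟩
    h (k + j * m)        ≡⟨ periodic-+* k j ⟩
    h k                  ∎
    where open ≡-Reasoning

  module _ .{{_ : NonZero m}} where

    periodic-% : ∀ k → h (k % m) ≡ h k
    periodic-% k = trans (sym (periodic-+* (k % m) (k / m))) (cong h (sym (m≡m%n+[m/n]*n k m)))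

    periodic-≤-argmax : ∀ k → h k ≤ h (argmax h 0 (upTo m))
    periodic-≤-argmax k =
      subst (_≤ h (argmax h 0 (upTo m))) (periodic-% k) (All.lookup (f[xs]≤f[argmax] {f = h} 0 (upTo m)) (∈-upTo⁺ (m%n<n k m)))

module _ {h : ℕ → ℕ} (convex : Convex h) {M} (bounded : ∀ k → h k ≤ M) where

  convex-max-pred : ∀ k → h (suc k) ≡ M → h k ≡ M
  convex-max-pred k hk≡M = ≤-antisym (bounded k) (+-cancelʳ-≤ M M (h k) (begin
    M + M                    ≡⟨ cong₂ _+_ hk≡M hk≡M ⟨
    h (suc k) + h (suc k)    ≤⟨ convex k ⟩
    h k + h (suc (suc k))    ≤⟨ +-monoʳ-≤ (h k) (bounded (suc (suc k))) ⟩
    h k + M                  ∎))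
    where open ≤-Reasoning

  convex-max-downward : ∀ k d → h (k + d) ≡ M → h k ≡ M
  convex-max-downward k zero    eq = trans (cong h (sym (+-identityʳ k))) eq
  convex-max-downward k (suc d) eq =
    convex-max-pred k (convex-max-downward (suc k) d (trans (cong h (sym (+-suc k d))) eq))

periodic-convex⇒constant : ∀ {m} .{{_ : NonZero m}} {h : ℕ → ℕ} →
  Periodic m h → Convex h → ∀ k → h k ≡ h 0
periodic-convex⇒constant {m} {h} periodic convex k = trans (attains-max k) (sym (attains-max 0))
  where
  r : ℕ
  r = argmax h 0 (upTo m)

  -- every k lies below r + k·m, a translate of the maximiser r
  attains-max : ∀ k → h k ≡ h r
  attains-max k = convex-max-downward convex (periodic-≤-argmax periodic) k (r + k * m ∸ k) (begin
    h (k + (r + k * m ∸ k))  ≡⟨ cong h (m+[n∸m]≡n (≤-trans (m≤m*n k m) (m≤n+m (k * m) r))) ⟩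
    h (r + k * m)            ≡⟨ periodic-+* periodic r k ⟩
    h r                      ∎)
    where open ≡-Reasoning

>1⇒*≢2 : ∀ {a b} → 1 < a → 1 < b → ¬ a * b ≡ 2
>1⇒*≢2 1<a 1<b ab≡2 with subst (4 ≤_) ab≡2 (*-mono-≤ 1<a 1<b)
... | s≤s (s≤s ())

≢1⇒>1 : ∀ {v} → 0 < v → ¬ v ≡ 1 → 1 < v
≢1⇒>1 {suc zero}    _ v≢1 = ⊥-elim (v≢1 refl)
≢1⇒>1 {suc (suc _)} _ _   = s≤s (s≤s z≤n)

%-≡⇒mod-≡ : ∀ {m} k l .{{_ : NonZero m}} → k % m ≡ l % m → k mod m ≡ l mod m
%-≡⇒mod-≡ _ _ eq = toℕ-injective (trans (toℕ-fromℕ< _) (trans eq (sym (toℕ-fromℕ< _))))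

toℕ-mod : ∀ {n} (i : Fin (suc n)) → toℕ i mod suc n ≡ i
toℕ-mod i = toℕ-injective (trans (toℕ-fromℕ< _) (m<n⇒m%n≡m (toℕ<n i)))

shift-mod : ∀ {n} k j → shift (k mod suc n) j ≡ (k + j) mod suc n
shift-mod {n} k j = %-≡⇒mod-≡ (toℕ (k mod m) + j) (k + j) (begin
  (toℕ (k mod m) + j) % m  ≡⟨ cong (λ z → (z + j) % m) (toℕ-fromℕ< (m%n<n k m)) ⟩
  (k % m + j) % m          ≡⟨ %-distribˡ-+ (k % m) j m ⟩
  (k % m % m + j % m) % m  ≡⟨ cong (λ z → (z + j % m) % m) (m%n%n≡m%n k m) ⟩
  (k % m + j % m) % m      ≡⟨ %-distribˡ-+ k j m ⟨
  (k + j) % m              ∎)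
  where
  m = suc n
  open ≡-Reasoning

W-peri : ∀ {m} (w : TaggedArc m → ℕ) i d (d<m : suc (suc d) < m) →
  W w i (suc (suc d)) ≡ w (peri i (suc (suc d)) (s≤s (s≤s z≤n)) d<m)
W-peri {m} w i d d<m with suc (suc d) <? m
... | yes d<m′ = cong (w ∘ peri i (suc (suc d)) (s≤s (s≤s z≤n))) (<-irrelevant d<m′ d<m)
... | no d≮m   = ⊥-elim (d≮m d<m)

module _ {n} {w : TaggedArc (suc n) → ℕ} (frieze : IsFrieze (suc n) w) where
  open IsFrieze frieze

  -- the shape shared by plainFlip and notchedFlip
  PunctureFlips : (Fin (suc n) → TaggedArc (suc n)) → Set
  PunctureFlips t = ∀ (a : Fin (suc n)) (j k : ℕ) → 0 < j → j < k → k < suc n →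
    W w a k * w (t (shift a j)) ≡ W w a j * w (t (shift a k)) + W w (shift a j) (k ∸ j) * w (t a)

  cyclic : (Fin (suc n) → TaggedArc (suc n)) → ℕ → ℕ
  cyclic t k = w (t (k mod suc n))

  cyclic-periodic : ∀ t → Periodic (suc n) (cyclic t)
  cyclic-periodic t k = cong (w ∘ t) (%-≡⇒mod-≡ (k + suc n) k ([m+n]%n≡m%n k (suc n)))

  puncture-flips-convex : 2 < suc n → (∀ a → 1 < W w a 2) →
    ∀ {t} → PunctureFlips t → Convex (cyclic t)
  puncture-flips-convex 2<m W>1 {t} flips k = begin
    h (suc k) + h (suc k)                   ≡⟨ cong (h (suc k) +_) (+-identityʳ (h (suc k))) ⟨
    2 * h (suc k)                           ≤⟨ *-monoˡ-≤ (h (suc k)) (W>1 a) ⟩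
    W w a 2 * h (suc k)                     ≡⟨ cong (W w a 2 *_) (shifted 1) ⟨
    W w a 2 * w (t (shift a 1))             ≡⟨ flips a 1 2 (s≤s z≤n) (s≤s (s≤s z≤n)) 2<m ⟩
    1 * w (t (shift a 2)) + 1 * w (t a)     ≡⟨ cong₂ _+_ (trans (*-identityˡ _) (shifted 2)) (*-identityˡ _) ⟩
    h (suc (suc k)) + h k                   ≡⟨ +-comm _ (h k) ⟩
    h k + h (suc (suc k))                   ∎
    where
    open ≤-Reasoning
    h = cyclic t
    a = k mod suc n
    shifted : ∀ j → w (t (shift a j)) ≡ h (j + k)
    shifted j = cong (w ∘ t) (trans (shift-mod k j) (cong (_mod suc n) (+-comm k j)))

  puncture-flips-constant : 2 < suc n → (∀ a → 1 < W w a 2) →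
    ∀ {t} → PunctureFlips t → ∀ i j → w (t i) ≡ w (t j)
  puncture-flips-constant 2<m W>1 {t} flips i j = begin
    w (t i)        ≡⟨ cong (w ∘ t) (toℕ-mod i) ⟨
    h (toℕ i)      ≡⟨ constant (toℕ i) ⟩
    h 0            ≡⟨ constant (toℕ j) ⟨
    h (toℕ j)      ≡⟨ cong (w ∘ t) (toℕ-mod j) ⟩
    w (t j)        ∎
    where
    open ≡-Reasoning
    h = cyclic t
    constant = periodic-convex⇒constant (cyclic-periodic t) (puncture-flips-convex 2<m W>1 flips)

  W-linear : ∀ {t} → PunctureFlips t → (∀ i j → w (t i) ≡ w (t j)) →
    ∀ a k → 0 < k → k < suc n → W w a k ≡ k
  W-linear flips constant a (suc zero)    _ _   = refl
  W-linear {t} flips constant a (suc (suc k)) _ k<m =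
    *-cancelʳ-≡ _ _ (w (t a)) {{>-nonZero (positive (t a))}} (begin
      W w a (2 + k) * w (t a)                  ≡⟨ cong (W w a (2 + k) *_) (constant a _) ⟩
      W w a (2 + k) * w (t (shift a (1 + k)))  ≡⟨ flips a (1 + k) (2 + k) (s≤s z≤n) ≤-refl k<m ⟩
      W w a (1 + k) * w (t (shift a (2 + k))) + W w (shift a (1 + k)) (1 + k ∸ k) * w (t a)
        ≡⟨ cong₂ _+_ (cong₂ _*_ (W-linear flips constant a (suc k) (s≤s z≤n) (<⇒≤ k<m)) (constant _ a))
                     (cong (λ d → W w (shift a (1 + k)) d * w (t a)) (m+n∸n≡m 1 k)) ⟩
      (1 + k) * w (t a) + 1 * w (t a)          ≡⟨ *-distribʳ-+ (w (t a)) (1 + k) 1 ⟨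
      (1 + k + 1) * w (t a)                    ≡⟨ cong (_* w (t a)) (+-comm (1 + k) 1) ⟩
      (2 + k) * w (t a)                        ∎)
    where open ≡-Reasoning

  peri-weight : (∀ a k → 0 < k → k < suc n → W w a k ≡ k) →
    ∀ d i (h₁ : 2 ≤ d) (h₂ : d < suc n) → w (peri i d h₁ h₂) ≡ d
  peri-weight linear (suc (suc d)) i (s≤s (s≤s z≤n)) h₂ = trans (sym (W-peri w i d h₂)) (linear i _ (s≤s z≤n) h₂)

  puncture-product : 0 < n → (∀ a k → 0 < k → k < suc n → W w a k ≡ k) →
    ∀ x y → (∀ i → w (notched i) ≡ x) → (∀ i → w (plain i) ≡ y) → x * y ≡ suc n
  puncture-product 0<n linear x y notched≡x plain≡y = begin
    x * y                                         ≡⟨ *-comm x y ⟩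
    y * x                                         ≡⟨ cong₂ _*_ (plain≡y zero) (notched≡x _) ⟨
    w (plain zero) * w (notched (shift zero 1))   ≡⟨ tagFlip zero 1 (s≤s z≤n) (s≤s 0<n) ⟩
    1 + W w (shift zero 1) n                      ≡⟨ cong suc (linear (shift zero 1) n 0<n ≤-refl) ⟩
    suc n                                         ∎
    where open ≡-Reasoning

lemma2p5 : (m : ℕ) → 2 ≤ m → (w : TaggedArc m → ℕ) → IsFrieze m w →
    (∀ γ → ¬ (w γ ≡ 1)) →
    ((∀ (i j : Fin m) → w (plain i) ≡ w (plain j))
      × (∀ (i j : Fin m) → w (notched i) ≡ w (notched j)))
    × (∀ (d : ℕ) (i : Fin m) (h₁ : 2 ≤ d) (h₂ : d < m) → w (peri i d h₁ h₂) ≡ d)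
    × (∀ (x y : ℕ) → (∀ (i : Fin m) → w (notched i) ≡ x) → (∀ (i : Fin m) → w (plain i) ≡ y) → x * y ≡ m)
lemma2p5 (suc zero) (s≤s ()) _ _ _
lemma2p5 (suc (suc zero)) _ w frieze w≢1 =
  ⊥-elim (>1⇒*≢2 (>1 (plain zero)) (>1 (notched _)) (tagFlip zero 1 (s≤s z≤n) (s≤s (s≤s z≤n))))
  where
  open IsFrieze frieze
  >1 : ∀ γ → 1 < w γ
  >1 γ = ≢1⇒>1 (positive γ) (w≢1 γ)
lemma2p5 m@(suc (suc (suc _))) _ w frieze w≢1 =
  (plain-constant , puncture-flips-constant frieze 2<m W>1 notchedFlip) ,
  peri-weight frieze linear , puncture-product frieze (s≤s z≤n) linear
  where
  open IsFrieze frieze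
  2<m : 2 < m
  2<m = s≤s (s≤s (s≤s z≤n))
  W>1 : ∀ a → 1 < W w a 2
  W>1 a = subst (1 <_) (sym (W-peri w a 0 2<m)) (≢1⇒>1 (positive _) (w≢1 _))
  plain-constant : ∀ i j → w (plain i) ≡ w (plain j)
  plain-constant = puncture-flips-constant frieze 2<m W>1 plainFlip
  linear : ∀ a k → 0 < k → k < m → W w a k ≡ k
  linear = W-linear frieze plainFlip plain-constant
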